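{- Let $n\ge 2$ be an integer and let $B_n=\{(1,1,\ldots,1),(2,1,\ldots,1),(1,2,1,\ldots,1),\ldots,(1,\ldots,1,2)\}\subset\mathbb{Z}^{n-1}$, i.e. $B_n$ consists of the all-ones vector $\mathbf j$ together with the vectors $\mathbf j+\mathbf e_i$ for $i=1,\ldots,n-1$, viewed as elements of $\mathbb{Z}_{n+1}^{\,n-1}=\mathbb{Z}_{n+1}\oplus\cdots\oplus\mathbb{Z}_{n+1}$ ($n-1$ summands). Then the Cayley digraph $D_n=\mathrm{Cay}(\mathbb{Z}_{n+1}^{\,n-1};B_n)$ has diameter $\binom{n}{2}$.
   Context: For an Abelian group $\Gamma$ and a generating set $A\subseteq\Gamma$, the Cayley digraph $\mathrm{Cay}(\Gamma;A)$ has vertex set $\Gamma$ and an arc $(u,v)$ if and only if $v-u\in A$. Its diameter is the maximum, over ordered pairs of vertices $(u,v)$, of the length of a shortest directed path from $u$ to $v$. $\mathbb{Z}_t$ denotes the cyclic group of integers modulo $t$. -}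

module Defs where

open import Data.Nat using (ℕ; zero; suc; _+_; _<_)
open import Data.Nat.DivMod using (_mod_)
open import Data.Fin using (Fin; toℕ)
import Data.Fin as F
open import Data.Vec using (Vec; []; _∷_; zipWith; replicate; updateAt)
open import Data.List using (List; []; _∷_; length; foldr)
open import Data.Product using (Σ; _×_; ∃; ∃₂)
open import Relation.Binary.PropositionalEquality using (_≡_)
open import Relation.Nullary using (¬_)

_+ₘ_ : ∀ {k} → Fin (suc k) → Fin (suc k) → Fin (suc k)
_+ₘ_ {k} a b = (toℕ a + toℕ b) mod (suc k)

-- The group ℤ_t^d (t = suc k) with componentwise addition.
Grp : ℕ → ℕ → Set
Grp k d = Vec (Fin (suc k)) d

_⊕_ : ∀ {k d} → Grp k d → Grp k d → Grp k d
_⊕_ = zipWith _+ₘ_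

-- A directed walk in Cay(Γ; A), A given as an indexed family gen : I → Γ.
-- A walk from u is a list of generator labels; it ends at u + (sum of generators).
walkEnd : ∀ {k d} {I : Set} → (I → Grp k d) → Grp k d → List I → Grp k d
walkEnd gen u []       = u
walkEnd gen u (i ∷ is) = walkEnd gen (u ⊕ gen i) is

PathOfLength : ∀ {k d} {I : Set} → (I → Grp k d) → Grp k d → Grp k d → ℕ → Set
PathOfLength gen u v ℓ = Σ (List _) λ w → (length w ≡ ℓ) × (walkEnd gen u w ≡ v)

HasDiameter : ∀ {k d} {I : Set} → (I → Grp k d) → ℕ → Set
HasDiameter {k} {d} gen D =
  (∀ (u v : Grp k d) → Σ ℕ λ ℓ → (ℓ Data.Nat.≤ D) × PathOfLength gen u v ℓ)
  × Σ (Grp k d) λ u → Σ (Grp k d) λ v →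
      PathOfLength gen u v D × (∀ ℓ → ℓ < D → ¬ PathOfLength gen u v ℓ)

-- The generating set B_n in ℤ_{n+1}^{n-1}, for n = suc (suc m):
-- dimension n-1 = suc m, modulus n+1 = suc (suc (suc m)), so k = suc (suc m).
one : ∀ {k} → Fin (suc (suc k))
one = F.suc F.zero

two : ∀ {k} → Fin (suc (suc (suc k)))
two = F.suc (F.suc F.zero)

B : (m : ℕ) → Fin (suc (suc m)) → Grp (suc (suc m)) (suc m)
B m F.zero    = replicate (suc m) one
B m (F.suc i) = updateAt (replicate (suc m) one) i (λ _ → two)

module Submission where

-- A walk of length ℓ that uses the generator j + e_i exactly c_i times
-- ends at u + ℓ·j + c, and every c with Σ c ≤ ℓ arises this way (pad with
-- copies of j).  So v is reachable from u in exactly ℓ steps iff some c with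
-- Σ c ≤ ℓ satisfies u_i + ℓ + c_i ≡ v_i (mod t) for every i (a "profile").
--
-- An affine map j ↦ a + s·j with s invertible mod t permutes ℤ_t,
-- so Σ_{j<t} (a + s·j) mod t = t C 2, and t naturals ≥ L lying in such an
-- affine progression mod t sum to at least t·L + t C 2.
--
-- From 0 to v = (D+1, …, D+d) the profile c_i = i+1 gives a
-- walk of length D.  For ℓ = D − δ with δ ≥ 1 a profile needs
-- c_i ≥ (δ+1+i) mod t; these d consecutive residues omit only two residues
-- of total at most n + δ − 1, so Σ c ≥ D + 1 − δ > ℓ.
--
-- For ℓ = D − j (j < t) take c_i = (z_i + j) mod t with
-- z_i ≡ v_i − u_i − D.  This is a profile as soon as f(j) = Σ c + j ≤ D.
-- Now f(j) ≡ f(0) + n·j runs through all residues, so if every f(j) exceeded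
-- D then Σ_j f(j) ≥ t(D+1) + t C 2; but Σ_j f(j) = n·(t C 2), which is less.

open import Defs
open import Data.Nat
open import Data.Nat.Properties
open import Data.Nat.DivMod
open import Data.Nat.Combinatorics using (_C_; nC1≡n; nCk+nC[k+1]≡[n+1]C[k+1])
open import Data.Nat.Tactic.RingSolver using (solve-∀)
open import Data.Fin using (Fin; toℕ) renaming (zero to fz; suc to fs)
open import Data.Fin.Properties using (toℕ<n; toℕ-fromℕ<; toℕ-injective; any?)
open import Data.Fin.Permutation using (Permutation; permutation; _⟨$⟩ʳ_)
open import Data.Vec using (lookup; replicate; tabulate; updateAt)
open import Data.Vec.Properties using (lookup-zipWith; lookup-replicate; lookup∘tabulate)
open import Data.Vec.Relation.Binary.Pointwise.Extensional using (ext; Pointwise-≡⇒≡)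
import Data.Vec.Functional as Vector
open import Data.List using (List; []; _∷_; length; _++_; map)
import Data.List as List
open import Data.List.Properties using (length-++; length-map; length-replicate)
open import Data.Product using (Σ; ∃; _×_; _,_)
open import Data.Empty using (⊥-elim)
open import Function using (_∘_)
open import Relation.Binary.PropositionalEquality
open import Relation.Nullary using (¬_; yes; no)
open import Algebra.Properties.CommutativeMonoid.Sum +-0-commutativeMonoid
  using (sum-syntax; ∑-distrib-+; ∑-comm; sum-cong-≗; sum-replicate-zero; ∑-permute)

C2-suc : ∀ n → suc n C 2 ≡ n + n C 2
C2-suc n = trans (sym (nCk+nC[k+1]≡[n+1]C[k+1] n 1)) (cong (_+ n C 2) (nC1≡n n))

-- 2·(n C 2) = n(n − 1), written without subtraction.
C2-double : ∀ n → 2 * (n C 2) + n ≡ n * n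
C2-double zero    = refl
C2-double (suc n) = begin
  2 * (suc n C 2) + suc n       ≡⟨ cong (λ x → 2 * x + suc n) (C2-suc n) ⟩
  2 * (n + n C 2) + suc n       ≡⟨ regroup n (n C 2) ⟩
  (2 * (n C 2) + n) + 2 * n + 1 ≡⟨ cong (λ x → x + 2 * n + 1) (C2-double n) ⟩
  n * n + 2 * n + 1             ≡⟨ square n ⟩
  suc n * suc n                 ∎
  where
  open ≡-Reasoning
  regroup : ∀ n x → 2 * (n + x) + suc n ≡ (2 * x + n) + 2 * n + 1
  regroup = solve-∀
  square : ∀ n → n * n + 2 * n + 1 ≡ suc n * suc n
  square = solve-∀

∑-mono : ∀ {k} (f g : Fin k → ℕ) → (∀ i → f i ≤ g i) → ∑[ i < k ] f i ≤ ∑[ i < k ] g i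
∑-mono {zero}  f g f≤g = z≤n
∑-mono {suc k} f g f≤g = +-mono-≤ (f≤g fz) (∑-mono (f ∘ fs) (g ∘ fs) (f≤g ∘ fs))

∑-const : ∀ k c → ∑[ i < k ] c ≡ k * c
∑-const zero    c = refl
∑-const (suc k) c = cong (c +_) (∑-const k c)

∑-toℕ : ∀ N → ∑[ j < N ] toℕ j ≡ N C 2
∑-toℕ zero    = refl
∑-toℕ (suc N) = begin
  ∑[ j < N ] (1 + toℕ j)                   ≡⟨ ∑-distrib-+ {N} (λ _ → 1) toℕ ⟩
  ∑[ j < N ] 1 + ∑[ j < N ] toℕ j          ≡⟨ cong₂ _+_ (trans (∑-const N 1) (*-identityʳ N)) (∑-toℕ N) ⟩
  N + N C 2                                ≡⟨ C2-suc N ⟨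
  suc N C 2                                ∎
  where open ≡-Reasoning

∑-snoc : ∀ N (g : ℕ → ℕ) → ∑[ j < suc N ] g (toℕ j) ≡ ∑[ j < N ] g (toℕ j) + g N
∑-snoc zero    g = +-comm (g 0) 0
∑-snoc (suc N) g = begin
  g 0 + ∑[ j < suc N ] g (suc (toℕ j))        ≡⟨ cong (g 0 +_) (∑-snoc N (g ∘ suc)) ⟩
  g 0 + (∑[ j < N ] g (suc (toℕ j)) + g (suc N)) ≡⟨ +-assoc (g 0) _ _ ⟨
  g 0 + ∑[ j < N ] g (suc (toℕ j)) + g (suc N)   ∎
  where open ≡-Reasoning

module Residues (t : ℕ) .{{_ : NonZero t}} where

  infix 4 _≋_
  _≋_ : ℕ → ℕ → Set
  a ≋ b = a % t ≡ b % t

  mod-≋ : ∀ a → a % t ≋ a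
  mod-≋ a = m%n%n≡m%n a t

  +-≋ : ∀ {a b c e} → a ≋ b → c ≋ e → a + c ≋ b + e
  +-≋ {a} {b} {c} {e} a≋b c≋e = begin
    (a + c) % t         ≡⟨ %-distribˡ-+ a c t ⟩
    (a % t + c % t) % t ≡⟨ cong₂ (λ x y → (x + y) % t) a≋b c≋e ⟩
    (b % t + e % t) % t ≡⟨ %-distribˡ-+ b e t ⟨
    (b + e) % t         ∎
    where open ≡-Reasoning

  *-≋ : ∀ {a b c e} → a ≋ b → c ≋ e → a * c ≋ b * e
  *-≋ {a} {b} {c} {e} a≋b c≋e = begin
    (a * c) % t         ≡⟨ %-distribˡ-* a c t ⟩
    (a % t * (c % t)) % t ≡⟨ cong₂ (λ x y → (x * y) % t) a≋b c≋e ⟩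
    (b % t * (e % t)) % t ≡⟨ %-distribˡ-* b e t ⟨
    (b * e) % t         ∎
    where open ≡-Reasoning

  -- Variants with explicit arguments, for use where t is concrete and
  -- _%_ computes, so that the summands cannot be inferred.
  +-≋ˡ : ∀ a b c → a ≋ b → a + c ≋ b + c
  +-≋ˡ a b c a≋b = +-≋ a≋b refl

  mod-+ˡ : ∀ a c → a % t + c ≋ a + c
  mod-+ˡ a c = +-≋ˡ (a % t) a c (mod-≋ a)

  mod-+ʳ : ∀ a c → a + c % t ≋ a + c
  mod-+ʳ a c = +-≋ {a} {a} {c % t} {c} refl (mod-≋ c)

  multiple-≋ : ∀ a k → a + k * t ≋ a
  multiple-≋ a k = [m+kn]%n≡m%n a k t

  unshift-≋ : ∀ a L → a ≋ a + L + pred t * L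
  unshift-≋ a L = begin
    a % t                     ≡⟨ multiple-≋ a L ⟨
    (a + L * t) % t           ≡⟨ cong (λ x → (a + L * x) % t) (suc-pred t) ⟨
    (a + L * suc (pred t)) % t ≡⟨ cong (_% t) (regroup a L (pred t)) ⟩
    (a + L + pred t * L) % t  ∎
    where
    open ≡-Reasoning
    regroup : ∀ a L p → a + L * suc p ≡ a + L + p * L
    regroup = solve-∀

  cancel-≋ : ∀ a b L → a + L ≋ b + L → a ≋ b
  cancel-≋ a b L eq = begin
    a % t                    ≡⟨ unshift-≋ a L ⟩
    (a + L + pred t * L) % t ≡⟨ +-≋ eq refl ⟩
    (b + L + pred t * L) % t ≡⟨ unshift-≋ b L ⟨
    b % t                    ∎
    where open ≡-Reasoning

  ∑-≋ : ∀ {k} (g : Fin k → ℕ) → ∑[ i < k ] (g i % t) ≋ ∑[ i < k ] g i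
  ∑-≋ {zero}  g = refl
  ∑-≋ {suc k} g = +-≋ (mod-≋ (g fz)) (∑-≋ (g ∘ fs))

  progression : ∀ (f : ℕ → ℕ) s → (∀ j → f (suc j) ≋ f j + s) → ∀ j → f j ≋ f 0 + s * j
  progression f s step zero    = cong (_% t) (sym (trans (cong (f 0 +_) (*-zeroʳ s)) (+-identityʳ (f 0))))
  progression f s step (suc j) = begin
    f (suc j) % t       ≡⟨ step j ⟩
    (f j + s) % t       ≡⟨ +-≋ (progression f s step j) refl ⟩
    (f 0 + s * j + s) % t ≡⟨ cong (_% t) (regroup (f 0) s j) ⟩
    (f 0 + s * suc j) % t ∎
    where
    open ≡-Reasoning
    regroup : ∀ a s j → a + s * j + s ≡ a + s * suc j
    regroup = solve-∀

  toℕ-mod : ∀ a → toℕ (a mod t) ≡ a % t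
  toℕ-mod a = toℕ-fromℕ< (m%n<n a t)

  -- If s·s' ≡ 1 (mod t), then j ↦ a + s·j is a permutation of ℤ_t with
  -- inverse y ↦ s'·(y − a), where −a is represented by (t − 1)·a.
  affine : ∀ a s s' → s * s' ≋ 1 → Permutation t t
  affine a s s' inv = permutation forward backward forward∘backward backward∘forward
    where
    forward backward : Fin t → Fin t
    forward  j = (a + s * toℕ j) mod t
    backward y = (s' * (toℕ y + pred t * a)) mod t

    reduced : ∀ (y : Fin t) → toℕ y % t ≡ toℕ y
    reduced y = m<n⇒m%n≡m (toℕ<n y)

    forward∘backward : ∀ y → forward (backward y) ≡ y
    forward∘backward y = toℕ-injective (begin
      toℕ (forward (backward y))             ≡⟨ toℕ-mod _ ⟩
      (a + s * toℕ (backward y)) % t          ≡⟨ +-≋ {a} refl (*-≋ {s} refl (trans (cong (_% t) (toℕ-mod _)) (mod-≋ _))) ⟩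
      (a + s * (s' * x)) % t                 ≡⟨ cong (_% t) (regroup a s s' x) ⟩
      (a + s * s' * x) % t                   ≡⟨ +-≋ {a} refl (*-≋ inv refl) ⟩
      (a + 1 * x) % t                        ≡⟨ cong (_% t) (regroup′ a (toℕ y) (pred t)) ⟩
      (toℕ y + a * suc (pred t)) % t         ≡⟨ cong (λ q → (toℕ y + a * q) % t) (suc-pred t) ⟩
      (toℕ y + a * t) % t                    ≡⟨ multiple-≋ (toℕ y) a ⟩
      toℕ y % t                              ≡⟨ reduced y ⟩
      toℕ y                                  ∎)
      where
      open ≡-Reasoning
      x : ℕ
      x = toℕ y + pred t * a
      regroup : ∀ a s s' x → a + s * (s' * x) ≡ a + s * s' * x
      regroup = solve-∀
      regroup′ : ∀ a y p → a + 1 * (y + p * a) ≡ y + a * suc p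
      regroup′ = solve-∀

    backward∘forward : ∀ j → backward (forward j) ≡ j
    backward∘forward j = toℕ-injective (begin
      toℕ (backward (forward j))                 ≡⟨ toℕ-mod _ ⟩
      (s' * (toℕ (forward j) + pred t * a)) % t  ≡⟨ *-≋ {s'} refl (+-≋ (trans (cong (_% t) (toℕ-mod _)) (mod-≋ _)) refl) ⟩
      (s' * (a + s * toℕ j + pred t * a)) % t    ≡⟨ cong (_% t) (regroup a s s' (toℕ j) (pred t)) ⟩
      (s * s' * toℕ j + (s' * a) * suc (pred t)) % t ≡⟨ cong (λ q → (s * s' * toℕ j + (s' * a) * q) % t) (suc-pred t) ⟩
      (s * s' * toℕ j + (s' * a) * t) % t        ≡⟨ multiple-≋ _ (s' * a) ⟩
      (s * s' * toℕ j) % t                       ≡⟨ *-≋ inv refl ⟩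
      (1 * toℕ j) % t                            ≡⟨ cong (_% t) (*-identityˡ (toℕ j)) ⟩
      toℕ j % t                                  ≡⟨ reduced j ⟩
      toℕ j                                      ∎)
      where
      open ≡-Reasoning
      regroup : ∀ a s s' j p → s' * (a + s * j + p * a) ≡ s * s' * j + (s' * a) * suc p
      regroup = solve-∀

  -- An affine progression with invertible step runs once through every residue.
  affine-sum : ∀ a s s' → s * s' ≋ 1 → ∑[ j < t ] ((a + s * toℕ j) % t) ≡ t C 2
  affine-sum a s s' inv = begin
    ∑[ j < t ] ((a + s * toℕ j) % t)        ≡⟨ sum-cong-≗ {t} (λ j → toℕ-mod (a + s * toℕ j)) ⟨
    ∑[ j < t ] toℕ (affine a s s' inv ⟨$⟩ʳ j) ≡⟨ ∑-permute toℕ (affine a s s' inv) ⟨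
    ∑[ j < t ] toℕ j                       ≡⟨ ∑-toℕ t ⟩
    t C 2                                  ∎
    where open ≡-Reasoning

  rotation-sum : ∀ a → ∑[ j < t ] ((a + toℕ j) % t) ≡ t C 2
  rotation-sum a = trans (sum-cong-≗ {t} (λ j → cong (λ x → (a + x) % t) (sym (*-identityˡ (toℕ j)))))
                         (affine-sum a 1 1 refl)

  progression-sum-≥ : ∀ (g : ℕ → ℕ) a s s' L → s * s' ≋ 1 →
                      (∀ (j : Fin t) → L ≤ g (toℕ j)) → (∀ j → g j ≋ a + s * j) →
                      t * L + t C 2 ≤ ∑[ j < t ] g (toℕ j)
  progression-sum-≥ g a s s' L inv above prog = begin
    t * L + t C 2                               ≡⟨ cong (t * L +_) (affine-sum a′ s s' inv) ⟨
    t * L + ∑[ j < t ] ((a′ + s * toℕ j) % t)   ≡⟨ cong (t * L +_) (sum-cong-≗ excess-residue) ⟨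
    t * L + ∑[ j < t ] (excess (toℕ j) % t)     ≤⟨ +-monoʳ-≤ (t * L) (∑-mono {t} _ _ (λ j → m%n≤m (excess (toℕ j)) t)) ⟩
    t * L + ∑[ j < t ] excess (toℕ j)           ≡⟨ +-comm (t * L) _ ⟩
    ∑[ j < t ] excess (toℕ j) + t * L           ≡⟨ cong (∑[ j < t ] excess (toℕ j) +_) (∑-const t L) ⟨
    ∑[ j < t ] excess (toℕ j) + ∑[ j < t ] L    ≡⟨ ∑-distrib-+ {t} (excess ∘ toℕ) (λ _ → L) ⟨
    ∑[ j < t ] (excess (toℕ j) + L)             ≡⟨ sum-cong-≗ {t} (λ j → m∸n+n≡m (above j)) ⟩
    ∑[ j < t ] g (toℕ j)                        ∎
    where
    open ≤-Reasoning
    excess : ℕ → ℕ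
    excess j = g j ∸ L
    a′ : ℕ
    a′ = a + pred t * L
    excess-residue : ∀ (j : Fin t) → excess (toℕ j) % t ≡ (a′ + s * toℕ j) % t
    excess-residue j = begin-equality
      excess (toℕ j) % t                        ≡⟨ unshift-≋ (excess (toℕ j)) L ⟩
      (excess (toℕ j) + L + pred t * L) % t     ≡⟨ cong (λ y → (y + pred t * L) % t) (m∸n+n≡m (above j)) ⟩
      (g (toℕ j) + pred t * L) % t              ≡⟨ +-≋ (prog (toℕ j)) refl ⟩
      (a + s * toℕ j + pred t * L) % t          ≡⟨ cong (_% t) (regroup a (s * toℕ j) (pred t * L)) ⟩
      (a′ + s * toℕ j) % t                      ∎
      where
      regroup : ∀ a b c → a + b + c ≡ a + c + b
      regroup = solve-∀

-- The last two of n + 1 consecutive residues mod (n + 1), those of δ + n ≡ δ − 1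
-- and of δ, add up to less than n + δ as soon as δ ≥ 1.
missing-residues : ∀ n δ → 1 ≤ δ → (δ + n) % suc n + δ % suc n < n + δ
missing-residues n δ 1≤δ =
  subst (λ x → x + δ % t < n + δ) (mod-+ˡ δ n) (bound (δ % t) (m%n<n δ t) (m%n≤m δ t))
  where
  t : ℕ
  t = suc n
  open Residues t
  bound : ∀ r → r < t → r ≤ δ → (r + n) % t + r < n + δ
  bound zero    _   _   = begin-strict
    n % t + 0 ≡⟨ cong (_+ 0) (m<n⇒m%n≡m (n<1+n n)) ⟩
    n + 0     <⟨ +-monoʳ-< n 1≤δ ⟩
    n + δ     ∎
    where open ≤-Reasoning
  bound (suc c) c<t c≤δ = begin-strict
    (suc c + n) % t + suc c ≡⟨ cong (λ x → x % t + suc c) (+-suc c n) ⟨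
    (c + t) % t + suc c     ≡⟨ cong (_+ suc c) ([m+n]%n≡m%n c t) ⟩
    c % t + suc c           ≡⟨ cong (_+ suc c) (m<n⇒m%n≡m (<-trans (n<1+n c) c<t)) ⟩
    c + suc c               <⟨ +-mono-≤ (s≤s⁻¹ c<t) c≤δ ⟩
    n + δ                   ∎
    where open ≤-Reasoning

averaging-gap : ∀ n → n * (suc n C 2) < suc n * suc (n C 2) + suc n C 2
averaging-gap n = begin-strict
  n * (suc n C 2)               ≡⟨ cong (n *_) (C2-suc n) ⟩
  n * (n + X)                   <⟨ m<m+n (n * (n + X)) z<s ⟩
  n * (n + X) + suc n           ≡⟨ regroup n X ⟩
  n * n + n * X + suc n         ≡⟨ cong (λ y → y + n * X + suc n) (C2-double n) ⟨
  2 * X + n + n * X + suc n     ≡⟨ regroup′ n X ⟩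
  suc n * suc X + (n + X)       ≡⟨ cong (suc n * suc X +_) (C2-suc n) ⟨
  suc n * suc X + suc n C 2     ∎
  where
  open ≤-Reasoning
  X : ℕ
  X = n C 2
  regroup : ∀ n X → n * (n + X) + suc n ≡ n * n + n * X + suc n
  regroup = solve-∀
  regroup′ : ∀ n X → 2 * X + n + n * X + suc n ≡ suc n * suc X + (n + X)
  regroup′ = solve-∀

kron : ∀ {k} → Fin k → Fin k → ℕ
kron fz     fz     = 1
kron fz     (fs _) = 0
kron (fs _) fz     = 0
kron (fs a) (fs b) = kron a b

∑-kron : ∀ {k} (a : Fin k) → ∑[ i < k ] kron a i ≡ 1
∑-kron {suc k} fz     = cong suc (sum-replicate-zero k)
∑-kron {suc k} (fs a) = ∑-kron a

occ : ∀ {k} → Fin k → List (Fin k) → ℕ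
occ a []      = 0
occ a (g ∷ w) = kron g a + occ a w

occ-++ : ∀ {k} (a : Fin k) xs ys → occ a (xs ++ ys) ≡ occ a xs + occ a ys
occ-++ a []       ys = refl
occ-++ a (x ∷ xs) ys = trans (cong (kron x a +_) (occ-++ a xs ys)) (sym (+-assoc (kron x a) _ _))

occ-replicate : ∀ {k} (a g : Fin k) r → occ a (List.replicate r g) ≡ r * kron g a
occ-replicate a g zero    = refl
occ-replicate a g (suc r) = cong (kron g a +_) (occ-replicate a g r)

occ-fz-map-fs : ∀ {k} (xs : List (Fin k)) → occ fz (map fs xs) ≡ 0
occ-fz-map-fs []       = refl
occ-fz-map-fs (x ∷ xs) = occ-fz-map-fs xs

occ-fs-map-fs : ∀ {k} (a : Fin k) xs → occ (fs a) (map fs xs) ≡ occ a xs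
occ-fs-map-fs a []       = refl
occ-fs-map-fs a (x ∷ xs) = cong (kron x a +_) (occ-fs-map-fs a xs)

spread : ∀ {k} → (Fin k → ℕ) → List (Fin k)
spread {zero}  c = []
spread {suc k} c = List.replicate (c fz) fz ++ map fs (spread (c ∘ fs))

occ-spread : ∀ {k} (c : Fin k → ℕ) a → occ a (spread c) ≡ c a
occ-spread {suc k} c fz = begin
  occ fz (List.replicate (c fz) fz ++ map fs rest)        ≡⟨ occ-++ fz (List.replicate (c fz) fz) _ ⟩
  occ fz (List.replicate (c fz) fz) + occ fz (map fs rest) ≡⟨ cong₂ _+_ (occ-replicate fz fz (c fz)) (occ-fz-map-fs rest) ⟩
  c fz * 1 + 0                                           ≡⟨ trans (+-identityʳ _) (*-identityʳ (c fz)) ⟩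
  c fz                                                   ∎
  where
  open ≡-Reasoning
  rest : List (Fin k)
  rest = spread (c ∘ fs)
occ-spread {suc k} c (fs a) = begin
  occ (fs a) (List.replicate (c fz) fz ++ map fs rest)          ≡⟨ occ-++ (fs a) (List.replicate (c fz) fz) _ ⟩
  occ (fs a) (List.replicate (c fz) fz) + occ (fs a) (map fs rest) ≡⟨ cong₂ _+_ (occ-replicate (fs a) fz (c fz)) (occ-fs-map-fs a rest) ⟩
  c fz * 0 + occ a rest                                        ≡⟨ cong₂ _+_ (*-zeroʳ (c fz)) (occ-spread (c ∘ fs) a) ⟩
  c (fs a)                                                     ∎
  where
  open ≡-Reasoning
  rest : List (Fin k)
  rest = spread (c ∘ fs)

length-spread : ∀ {k} (c : Fin k → ℕ) → length (spread c) ≡ ∑[ i < k ] c i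
length-spread {zero}  c = refl
length-spread {suc k} c = begin
  length (List.replicate (c fz) fz ++ map fs (spread (c ∘ fs)))            ≡⟨ length-++ (List.replicate (c fz) fz) ⟩
  length (List.replicate (c fz) fz) + length (map fs (spread (c ∘ fs)))    ≡⟨ cong₂ _+_ (length-replicate (c fz)) (length-map fs (spread (c ∘ fs))) ⟩
  c fz + length (spread (c ∘ fs))                                          ≡⟨ cong (c fz +_) (length-spread (c ∘ fs)) ⟩
  c fz + ∑[ i < k ] c (fs i)                                               ∎
  where open ≡-Reasoning

module Cayley (m : ℕ) where

  d n t D : ℕ
  d = suc m
  n = suc d
  t = suc n
  D = n C 2

  G : Set
  G = Grp n d

  open Residues t

  coord : G → Fin d → ℕ
  coord u i = toℕ (lookup u i)

  coord-⊕ : ∀ u v i → coord (u ⊕ v) i ≡ (coord u i + coord v i) % t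
  coord-⊕ u v i = trans (cong toℕ (lookup-zipWith _+ₘ_ i u v)) (toℕ-mod (coord u i + coord v i))

  coord-raised : ∀ {k} (a i : Fin k) →
                 toℕ (lookup (updateAt (replicate k (one {d})) a (λ _ → two {m})) i) ≡ suc (kron a i)
  coord-raised fz     fz     = refl
  coord-raised fz     (fs i) = cong toℕ (lookup-replicate i one)
  coord-raised (fs a) fz     = refl
  coord-raised (fs a) (fs i) = coord-raised a i

  coord-B : ∀ g i → coord (B m g) i ≡ suc (kron g (fs i))
  coord-B fz     i = cong toℕ (lookup-replicate i one)
  coord-B (fs a) i = coord-raised a i

  uses : Fin d → List (Fin n) → ℕ
  uses i w = occ (fs i) w

  -- Every step adds 1 to each coordinate, plus 1 more to coordinate i for j + e_i.
  walk-coord : ∀ w u i → coord (walkEnd (B m) u w) i ≡ (coord u i + length w + uses i w) % t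
  walk-coord []      u i = sym (begin
    (coord u i + 0 + 0) % t ≡⟨ cong (_% t) (trans (+-identityʳ _) (+-identityʳ (coord u i))) ⟩
    coord u i % t           ≡⟨ m<n⇒m%n≡m (toℕ<n (lookup u i)) ⟩
    coord u i               ∎)
    where open ≡-Reasoning
  walk-coord (g ∷ w) u i = begin
    coord (walkEnd (B m) (u ⊕ B m g) w) i                    ≡⟨ walk-coord w (u ⊕ B m g) i ⟩
    (coord (u ⊕ B m g) i + length w + uses i w) % t          ≡⟨ cong (λ r → (r + length w + uses i w) % t) (coord-⊕ u (B m g) i) ⟩
    ((x + y) % t + length w + uses i w) % t                  ≡⟨ cong (_% t) (+-assoc ((x + y) % t) (length w) (uses i w)) ⟩
    ((x + y) % t + (length w + uses i w)) % t                ≡⟨ mod-+ˡ (x + y) (length w + uses i w) ⟩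
    (x + y + (length w + uses i w)) % t                      ≡⟨ cong (λ r → (x + r + (length w + uses i w)) % t) (coord-B g i) ⟩
    (x + suc (kron g (fs i)) + (length w + uses i w)) % t    ≡⟨ cong (_% t) (regroup x (kron g (fs i)) (length w) (uses i w)) ⟩
    (x + suc (length w) + (kron g (fs i) + uses i w)) % t    ∎
    where
    open ≡-Reasoning
    x y : ℕ
    x = coord u i
    y = coord (B m g) i
    regroup : ∀ x a l k → x + suc a + (l + k) ≡ x + suc l + (a + k)
    regroup = solve-∀

  uses-total : ∀ w → ∑[ i < d ] uses i w ≤ length w
  uses-total []      = ≤-reflexive (sum-replicate-zero d)
  uses-total (g ∷ w) = begin
    ∑[ i < d ] (kron g (fs i) + uses i w)           ≡⟨ ∑-distrib-+ {d} (kron g ∘ fs) (λ i → uses i w) ⟩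
    ∑[ i < d ] kron g (fs i) + ∑[ i < d ] uses i w  ≤⟨ +-mono-≤ (at-most-one g) (uses-total w) ⟩
    1 + length w                                    ∎
    where
    open ≤-Reasoning
    at-most-one : ∀ g → ∑[ i < d ] kron g (fs i) ≤ 1
    at-most-one fz     = ≤-trans (≤-reflexive (sum-replicate-zero d)) z≤n
    at-most-one (fs a) = ≤-reflexive (∑-kron a)

  Profile : G → G → ℕ → (Fin d → ℕ) → Set
  Profile u v ℓ c = ∑[ i < d ] c i ≤ ℓ × (∀ i → (coord u i + ℓ + c i) % t ≡ coord v i)

  path⇒profile : ∀ u v ℓ → PathOfLength (B m) u v ℓ → ∃ (Profile u v ℓ)
  path⇒profile u v ℓ (w , refl , refl) = (λ i → uses i w) , uses-total w , (λ i → sym (walk-coord w u i))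

  -- Realise a profile by c i copies of each j + e_i, padded with copies of j.
  profile⇒path : ∀ u v ℓ c → Profile u v ℓ c → PathOfLength (B m) u v ℓ
  profile⇒path u v ℓ c (∑c≤ℓ , hits) = w , length-w , Pointwise-≡⇒≡ (ext λ i → toℕ-injective (begin
    coord (walkEnd (B m) u w) i            ≡⟨ walk-coord w u i ⟩
    (coord u i + length w + uses i w) % t  ≡⟨ cong₂ (λ x y → (coord u i + x + y) % t) length-w (occ-spread c′ (fs i)) ⟩
    (coord u i + ℓ + c i) % t              ≡⟨ hits i ⟩
    coord v i                              ∎))
    where
    open ≡-Reasoning
    c′ : Fin n → ℕ
    c′ = (ℓ ∸ ∑[ i < d ] c i) Vector.∷ c
    w : List (Fin n)
    w = spread c′
    length-w : length w ≡ ℓ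
    length-w = trans (length-spread c′) (m∸n+n≡m ∑c≤ℓ)

  origin target : G
  origin = replicate d fz
  target = tabulate (λ i → (D + 1 + toℕ i) mod t)

  coord-origin : ∀ i → coord origin i ≡ 0
  coord-origin i = cong toℕ (lookup-replicate i fz)

  coord-target : ∀ i → coord target i ≡ (D + 1 + toℕ i) % t
  coord-target i = trans (cong toℕ (lookup∘tabulate (λ i → (D + 1 + toℕ i) mod t) i)) (toℕ-mod (D + 1 + toℕ i))

  long-path : PathOfLength (B m) origin target D
  long-path = profile⇒path origin target D (λ i → suc (toℕ i)) (≤-reflexive (∑-toℕ n) , hits)
    where
    hits : ∀ i → (coord origin i + D + suc (toℕ i)) % t ≡ coord target i
    hits i = begin
      (coord origin i + D + suc (toℕ i)) % t ≡⟨ cong (λ x → (x + D + suc (toℕ i)) % t) (coord-origin i) ⟩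
      (D + suc (toℕ i)) % t                  ≡⟨ cong (_% t) (+-assoc D 1 (toℕ i)) ⟨
      (D + 1 + toℕ i) % t                    ≡⟨ coord-target i ⟨
      coord target i                         ∎
      where open ≡-Reasoning

  window-sum : ∀ δ → 1 ≤ δ → D + 1 ≤ ∑[ i < d ] ((δ + 1 + toℕ i) % t) + δ
  window-sum δ 1≤δ = +-cancelˡ-≤ n (D + 1) (X + δ) (begin
    n + (D + 1)          ≡⟨ trans (cong (n +_) (+-comm D 1)) (+-suc n D) ⟩
    suc (n + D)          ≡⟨ cong suc full-period ⟨
    suc (X + g d + g n)  ≡⟨ regroup X (g d) (g n) ⟩
    X + suc (g d + g n)  ≤⟨ +-monoʳ-≤ X missing ⟩
    X + (n + δ)          ≡⟨ regroup′ X n δ ⟩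
    n + (X + δ)          ∎)
    where
    open ≤-Reasoning
    g : ℕ → ℕ
    g j = (δ + 1 + j) % t
    X : ℕ
    X = ∑[ i < d ] g (toℕ i)
    full-period : X + g d + g n ≡ n + D
    full-period = begin-equality
      X + g d + g n               ≡⟨ cong (_+ g n) (∑-snoc d g) ⟨
      ∑[ j < n ] g (toℕ j) + g n  ≡⟨ ∑-snoc n g ⟨
      ∑[ j < t ] g (toℕ j)        ≡⟨ rotation-sum (δ + 1) ⟩
      t C 2                       ≡⟨ C2-suc n ⟩
      n + D                       ∎
    -- The two residues left out of the full period.
    missing : g d + g n < n + δ
    missing = subst₂ (λ x y → x + y < n + δ)
                (cong (_% t) (sym (+-assoc δ 1 d)))
                (sym (trans (cong (_% t) (+-assoc δ 1 n)) ([m+n]%n≡m%n δ t)))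
                (missing-residues n δ 1≤δ)
    regroup : ∀ X a b → suc (X + a + b) ≡ X + suc (a + b)
    regroup = solve-∀
    regroup′ : ∀ X n δ → X + (n + δ) ≡ n + (X + δ)
    regroup′ = solve-∀

  no-short-path : ∀ ℓ → ℓ < D → ¬ PathOfLength (B m) origin target ℓ
  no-short-path ℓ ℓ<D path with path⇒profile origin target ℓ path
  ... | c , ∑c≤ℓ , hits = 1+n≰n (begin
    suc D                                         ≡⟨ +-comm 1 D ⟩
    D + 1                                         ≤⟨ window-sum δ 1≤δ ⟩
    ∑[ i < d ] ((δ + 1 + toℕ i) % t) + δ          ≤⟨ +-monoˡ-≤ δ (∑-mono {d} (λ i → (δ + 1 + toℕ i) % t) c lower) ⟩
    ∑[ i < d ] c i + δ                            ≤⟨ +-monoˡ-≤ δ ∑c≤ℓ ⟩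
    ℓ + δ                                         ≡⟨ m+[n∸m]≡n (<⇒≤ ℓ<D) ⟩
    D                                             ∎)
    where
    open ≤-Reasoning
    δ : ℕ
    δ = D ∸ ℓ
    1≤δ : 1 ≤ δ
    1≤δ = m+n≤o⇒m≤o∸n 1 ℓ<D
    -- c_i ≡ δ + 1 + i (mod t), so c_i is at least that residue.
    lower : ∀ i → (δ + 1 + toℕ i) % t ≤ c i
    lower i = subst (_≤ c i) (cancel-≋ (c i) (δ + 1 + toℕ i) ℓ congruent) (m%n≤m (c i) t)
      where
      congruent : c i + ℓ ≋ δ + 1 + toℕ i + ℓ
      congruent = begin-equality
        (c i + ℓ) % t                    ≡⟨ cong (_% t) (+-comm (c i) ℓ) ⟩
        (ℓ + c i) % t                    ≡⟨ cong (λ x → (x + ℓ + c i) % t) (coord-origin i) ⟨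
        (coord origin i + ℓ + c i) % t   ≡⟨ hits i ⟩
        coord target i                   ≡⟨ coord-target i ⟩
        (D + 1 + toℕ i) % t              ≡⟨ cong (λ x → (x + 1 + toℕ i) % t) (m+[n∸m]≡n (<⇒≤ ℓ<D)) ⟨
        (ℓ + δ + 1 + toℕ i) % t          ≡⟨ cong (_% t) (regroup ℓ δ (toℕ i)) ⟩
        (δ + 1 + toℕ i + ℓ) % t          ∎
        where
        regroup : ∀ ℓ δ i → ℓ + δ + 1 + i ≡ δ + 1 + i + ℓ
        regroup = solve-∀

  -- n ≡ −1 (mod t), so n is its own inverse mod t.
  n-self-inverse : n * n ≋ 1
  n-self-inverse = trans (cong (_% t) (square m)) (multiple-≋ 1 d)
    where
    square : ∀ m → suc (suc m) * suc (suc m) ≡ 1 + suc m * suc (suc (suc m))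
    square = solve-∀

  module Reach (u v : G) where

    -- z_i ≡ v_i − u_i − D (mod t), using −1 ≡ n.
    z : Fin d → ℕ
    z i = coord v i + n * (coord u i + D)

    -- So a profile for length D − j needs c_i ≡ z_i + j (mod t).
    z-spec : ∀ i → coord u i + D + z i ≋ coord v i
    z-spec i = trans (cong (_% t) (regroup (coord u i + D) (coord v i) m)) (multiple-≋ (coord v i) (coord u i + D))
      where
      regroup : ∀ x y m → x + (y + suc (suc m) * x) ≡ y + x * suc (suc (suc m))
      regroup = solve-∀

    S f : ℕ → ℕ
    S j = ∑[ i < d ] ((z i + j) % t)
    f j = S j + j

    candidate-path : ∀ j → f j ≤ D → PathOfLength (B m) u v (D ∸ j)
    candidate-path j fj≤D = profile⇒path u v (D ∸ j) (λ i → (z i + j) % t) (m+n≤o⇒m≤o∸n (S j) fj≤D , hits)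
      where
      j≤D : j ≤ D
      j≤D = ≤-trans (m≤n+m j (S j)) fj≤D
      hits : ∀ i → (coord u i + (D ∸ j) + (z i + j) % t) % t ≡ coord v i
      hits i = begin
        (x + (D ∸ j) + (z i + j) % t) % t ≡⟨ mod-+ʳ (x + (D ∸ j)) (z i + j) ⟩
        (x + (D ∸ j) + (z i + j)) % t     ≡⟨ cong (_% t) (regroup x (D ∸ j) (z i) j) ⟩
        (x + ((D ∸ j) + j) + z i) % t     ≡⟨ cong (λ y → (x + y + z i) % t) (m∸n+n≡m j≤D) ⟩
        (x + D + z i) % t                 ≡⟨ z-spec i ⟩
        coord v i % t                     ≡⟨ m<n⇒m%n≡m (toℕ<n (lookup v i)) ⟩
        coord v i                         ∎
        where
        open ≡-Reasoning
        x : ℕ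
        x = coord u i
        regroup : ∀ x a b j → x + a + (b + j) ≡ x + (a + j) + b
        regroup = solve-∀

    -- Increasing j by one adds d to S (mod t) and 1 to j, hence n to f.
    f-step : ∀ j → f (suc j) ≋ f j + n
    f-step j = begin
      (S (suc j) + suc j) % t ≡⟨ +-≋ˡ (S (suc j)) (S j + d) (suc j) S-step ⟩
      (S j + d + suc j) % t   ≡⟨ cong (_% t) (regroup (S j) d j) ⟩
      (S j + j + n) % t       ∎
      where
      open ≡-Reasoning
      regroup : ∀ s d j → s + d + suc j ≡ s + j + suc d
      regroup = solve-∀
      +-suc-last : ∀ a j → a + suc j ≡ a + j + 1
      +-suc-last = solve-∀
      S-step : S (suc j) ≋ S j + d
      S-step = begin
        S (suc j) % t                                    ≡⟨ ∑-≋ (λ i → z i + suc j) ⟩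
        (∑[ i < d ] (z i + suc j)) % t                   ≡⟨ cong (_% t) (sum-cong-≗ {d} (λ i → +-suc-last (z i) j)) ⟩
        (∑[ i < d ] (z i + j + 1)) % t                   ≡⟨ cong (_% t) (∑-distrib-+ {d} (λ i → z i + j) (λ _ → 1)) ⟩
        (∑[ i < d ] (z i + j) + ∑[ i < d ] 1) % t        ≡⟨ +-≋ˡ (∑[ i < d ] (z i + j)) (S j) (∑[ i < d ] 1) (sym (∑-≋ (λ i → z i + j))) ⟩
        (S j + ∑[ i < d ] 1) % t                         ≡⟨ cong (λ y → (S j + y) % t) (trans (∑-const d 1) (*-identityʳ d)) ⟩
        (S j + d) % t                                    ∎

    -- Summed over all shifts, each coordinate contributes one full period.
    f-total : ∑[ j < t ] f (toℕ j) ≡ n * (t C 2)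
    f-total = begin
      ∑[ j < t ] (S (toℕ j) + toℕ j)                       ≡⟨ ∑-distrib-+ {t} (S ∘ toℕ) toℕ ⟩
      ∑[ j < t ] S (toℕ j) + ∑[ j < t ] toℕ j              ≡⟨ cong₂ _+_ (∑-comm {t} {d} (λ j i → (z i + toℕ j) % t)) (∑-toℕ t) ⟩
      ∑[ i < d ] ∑[ j < t ] ((z i + toℕ j) % t) + t C 2    ≡⟨ cong (_+ t C 2) (sum-cong-≗ {d} (rotation-sum ∘ z)) ⟩
      ∑[ i < d ] (t C 2) + t C 2                          ≡⟨ cong (_+ t C 2) (∑-const d (t C 2)) ⟩
      d * (t C 2) + t C 2                                 ≡⟨ +-comm (d * (t C 2)) (t C 2) ⟩
      n * (t C 2)                                         ∎
      where open ≡-Reasoning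

    -- Averaging: some shift j < t has f j ≤ D.  Otherwise f(0), …, f(n), an
    -- affine progression of step n mod t, all exceed D and sum to ≥ t(D+1) + t C 2.
    good-shift : ∃ λ (j : Fin t) → f (toℕ j) ≤ D
    good-shift with any? (λ j → f (toℕ j) ≤? D)
    ... | yes found = found
    ... | no  none  = ⊥-elim (<⇒≱ (averaging-gap n) (begin
      t * suc D + t C 2     ≤⟨ progression-sum-≥ f (f 0) n n (suc D) n-self-inverse
                                 (λ j → ≰⇒> (λ fj≤D → none (j , fj≤D))) (progression f n f-step) ⟩
      ∑[ j < t ] f (toℕ j)  ≡⟨ f-total ⟩
      n * (t C 2)           ∎))
      where open ≤-Reasoning

    short-path : Σ ℕ λ ℓ → ℓ ≤ D × PathOfLength (B m) u v ℓ
    short-path with good-shift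
    ... | j , fj≤D = D ∸ toℕ j , m∸n≤m D (toℕ j) , candidate-path (toℕ j) fj≤D

mainTheorem2 : (m : ℕ) → HasDiameter (B m) (suc (suc m) C 2)
mainTheorem2 m = Reach.short-path , origin , target , long-path , no-short-path
  where open Cayley m
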